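{- Let $\mathcal{C}=\{c_1,\ldots,c_m\}$ be a collection of cliques with graph union $U$ on vertex set $V$. For $H\subseteq V$, the induced subgraph $U[H]$ is a clique (complete graph) if and only if its support $S(H)=\{J\subseteq\{1,\ldots,m\}: \Gamma_J\cap H\neq\emptyset\}$ is an intersecting family.
   Context: A clique is identified with its vertex set. The graph union $U$ of $c_1,\ldots,c_m$ has vertex set $V=\bigcup_j c_j$, and distinct $u,v\in V$ are adjacent iff $u,v\in c_j$ for some $j$. For $J\subseteq\{1,\ldots,m\}$, $\Gamma_J$ is the set of $v\in V$ with $\{j:v\in c_j\}=J$. A family of sets is intersecting if any two distinct members have nonempty intersection. -}

module Defs where

open import Data.Nat using (ℕ)
open import Data.Fin using (Fin)
open import Data.Fin.Subset using (Subset; _∈_; _∩_; Nonempty)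
open import Data.Product using (_×_; ∃-syntax)
open import Relation.Binary.PropositionalEquality using (_≢_)
open import Relation.Nullary using (¬_)
open import Function.Bundles using (_⇔_)

-- A collection of m cliques c₁,…,cₘ on the finite vertex universe Fin n,
-- each clique identified with its vertex set.
Cliques : ℕ → ℕ → Set
Cliques m n = Fin m → Subset n

module _ {m n : ℕ} (c : Cliques m n) where

  InV : Fin n → Set
  InV v = ∃[ j ] (v ∈ c j)

  SubsetOfV : Subset n → Set
  SubsetOfV H = ∀ v → v ∈ H → InV v

  Adjacent : Fin n → Fin n → Set
  Adjacent u v = u ≢ v × ∃[ j ] (u ∈ c j × v ∈ c j)

  InducedIsClique : Subset n → Set
  InducedIsClique H = ∀ u v → u ∈ H → v ∈ H → u ≢ v → Adjacent u v

  -- v ∈ Γ_J : v ∈ V and {j : v ∈ cⱼ} = J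
  InΓ : Subset m → Fin n → Set
  InΓ J v = InV v × (∀ j → (v ∈ c j ⇔ j ∈ J))

  InSupport : Subset n → Subset m → Set
  InSupport H J = ∃[ v ] (InΓ J v × v ∈ H)

Intersecting : {m : ℕ} → (Subset m → Set) → Set
Intersecting {m} F = ∀ (J K : Subset m) → F J → F K → J ≢ K → Nonempty (J ∩ K)

{-# OPTIONS --safe #-}
-- Every v ∈ V lies in exactly one class Γ_J, namely J = {j : v ∈ cⱼ}, and two
-- vertices share a clique iff their classes' index sets meet. So for distinct
-- u, v ∈ H in different classes adjacency is exactly the intersecting condition,
-- while u, v in the same class Γ_J are adjacent because J ≠ ∅.
module Submission where

open import Defs
open import Level using (Level)
open import Data.Nat using (ℕ; zero; suc)
open import Data.Fin using (Fin; zero; suc)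
open import Data.Fin.Subset using (Subset; _∈_; _∩_; Nonempty)
open import Data.Fin.Subset.Properties using (_∈?_; ⊆-antisym; x∈p∩q⁺; x∈p∩q⁻)
open import Data.Bool.Properties using () renaming (_≟_ to _≟ᵇ_)
open import Data.Vec using ([]; _∷_; here; there)
open import Data.Vec.Properties using (≡-dec)
open import Data.Product using (_×_; _,_; ∃-syntax; proj₂)
open import Function using (_∘_)
open import Function.Bundles using (_⇔_; mk⇔; Equivalence)
open import Function.Properties.Equivalence using () renaming (sym to ⇔-sym)
open import Relation.Nullary using (yes; no; does; contradiction)
open import Relation.Unary using (Pred; Decidable)
open import Relation.Binary.PropositionalEquality using (_≡_; _≢_; refl; subst)

open Equivalence

private
  variable
    ℓ : Level
    m n : ℕ

indexSet : {P : Pred (Fin m) ℓ} → Decidable P → Subset m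
indexSet {m = zero}  P? = []
indexSet {m = suc m} P? = does (P? zero) ∷ indexSet (P? ∘ suc)

∈-indexSet : {P : Pred (Fin m) ℓ} (P? : Decidable P) (j : Fin m) → j ∈ indexSet P? ⇔ P j
∈-indexSet P? zero with P? zero
... | yes p = mk⇔ (λ _ → p) (λ _ → here)
... | no ¬p = mk⇔ (λ ()) (λ p → contradiction p ¬p)
∈-indexSet P? (suc j) =
  mk⇔ (λ { (there j∈) → to (∈-indexSet (P? ∘ suc) j) j∈ })
      (there ∘ from (∈-indexSet (P? ∘ suc) j))

module _ (c : Cliques m n) where

  memberships : Fin n → Subset m
  memberships v = indexSet (λ j → v ∈? c j)

  InΓ-memberships : ∀ {v} → InV c v → InΓ c (memberships v) v
  InΓ-memberships v∈V = v∈V , λ j → ⇔-sym (∈-indexSet _ j)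

  InΓ-functional : ∀ {J K v} → InΓ c J v → InΓ c K v → J ≡ K
  InΓ-functional (_ , v∈⇔J) (_ , v∈⇔K) =
    ⊆-antisym (λ {j} → to (v∈⇔K j) ∘ from (v∈⇔J j))
              (λ {j} → to (v∈⇔J j) ∘ from (v∈⇔K j))

  InΓ-nonempty : ∀ {J v} → InΓ c J v → Nonempty J
  InΓ-nonempty ((j , v∈cⱼ) , v∈⇔J) = j , to (v∈⇔J j) v∈cⱼ

  shareClique⇔meet : ∀ {J K u v} → InΓ c J u → InΓ c K v →
                     (∃[ j ] (u ∈ c j × v ∈ c j)) ⇔ Nonempty (J ∩ K)
  shareClique⇔meet {J} {K} (_ , u∈⇔J) (_ , v∈⇔K) = mk⇔
    (λ (j , u∈cⱼ , v∈cⱼ) → j , x∈p∩q⁺ (to (u∈⇔J j) u∈cⱼ , to (v∈⇔K j) v∈cⱼ))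
    (λ (j , j∈J∩K) → let j∈J , j∈K = x∈p∩q⁻ J K j∈J∩K
                     in j , from (u∈⇔J j) j∈J , from (v∈⇔K j) j∈K)

proposition4p12 : ∀ {m n : ℕ} (c : Cliques m n) (H : Subset n) → SubsetOfV c H →
                    (InducedIsClique c H ⇔ Intersecting (InSupport c H))
proposition4p12 c H H⊆V = mk⇔ clique⇒intersecting intersecting⇒clique
  where
  clique⇒intersecting : InducedIsClique c H → Intersecting (InSupport c H)
  clique⇒intersecting clique J K (u , Γu , u∈H) (v , Γv , v∈H) J≢K =
    to (shareClique⇔meet c Γu Γv) (proj₂ (clique u v u∈H v∈H u≢v))
    where
    u≢v : u ≢ v
    u≢v refl = J≢K (InΓ-functional c Γu Γv)

  intersecting⇒clique : Intersecting (InSupport c H) → InducedIsClique c H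
  intersecting⇒clique intersecting u v u∈H v∈H u≢v =
    u≢v , from (shareClique⇔meet c Γu Γv) meet
    where
    Γu : InΓ c (memberships c u) u
    Γu = InΓ-memberships c (H⊆V u u∈H)
    Γv : InΓ c (memberships c v) v
    Γv = InΓ-memberships c (H⊆V v v∈H)
    meet : Nonempty (memberships c u ∩ memberships c v)
    meet with ≡-dec _≟ᵇ_ (memberships c u) (memberships c v)
    ... | yes Ju≡Jv = let j , j∈Ju = InΓ-nonempty c Γu
                      in j , x∈p∩q⁺ (j∈Ju , subst (j ∈_) Ju≡Jv j∈Ju)
    ... | no Ju≢Jv = intersecting _ _ (u , Γu , u∈H) (v , Γv , v∈H) Ju≢Jv
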